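{- For every integer $d\geq1$, the polynomial $T_d(x,k)$ in $x$ and $k$ which for nonnegative integers $k$ equals $\sum_{0\leq\gamma_1<\dots<\gamma_d<k}(x+\gamma_1)\cdots(x+\gamma_d)$ is divisible by $k$.
   Context: That this sum is given by a polynomial in $x$ and $k$ is a separate known result. -}

module Defs where

open import Data.Nat using (ℕ; zero; suc)
open import Data.List using (List; []; _∷_; map; _++_; foldr; upTo)
open import Data.Integer using (+_)
open import Data.Rational using (ℚ; 0ℚ; 1ℚ; _+_; _*_; _/_)

ℕ→ℚ : ℕ → ℚ
ℕ→ℚ n = + n / 1

sumℚ : List ℚ → ℚ
sumℚ = foldr _+_ 0ℚ

productℚ : List ℚ → ℚ
productℚ = foldr _*_ 1ℚ

-- all order-preserving sublists of length d of a list;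
-- applied to  upTo k = [0,1,…,k-1]  these are exactly the sequences
-- 0 ≤ γ₁ < … < γ_d < k
combos : ℕ → List ℕ → List (List ℕ)
combos zero _ = [] ∷ []
combos (suc d) [] = []
combos (suc d) (a ∷ as) = map (a ∷_) (combos d as) ++ combos (suc d) as

T : ℕ → ℕ → ℚ → ℚ
T d k x = sumℚ (map (λ γs → productℚ (map (λ g → x + ℕ→ℚ g) γs)) (combos d (upTo k)))

-- univariate polynomials over ℚ: coefficient lists [c₀, c₁, …] (Horner evaluation)
Poly : Set
Poly = List ℚ

evalPoly : Poly → ℚ → ℚ
evalPoly [] _ = 0ℚ
evalPoly (c ∷ cs) x = c + x * evalPoly cs x

-- bivariate polynomials over ℚ in (x,k): Σ_j P_j(x) k^j, stored as [P₀, P₁, …]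
Poly2 : Set
Poly2 = List Poly

eval2 : Poly2 → ℚ → ℚ → ℚ
eval2 [] _ _ = 0ℚ
eval2 (p ∷ ps) x k = evalPoly p x + k * eval2 ps x k

-- Since the γ-sequences below k+1 either avoid k or end in it,
-- T_{d+1}(x,k+1) = T_{d+1}(x,k) + (x+k) T_d(x,k) and T_{d+1}(x,0) = 0: T_{d+1} is the
-- indefinite sum in k of (x+k) T_d. Write a function of (x,k) as a Newton series
-- Σ_j a_j(x) C(k,j); multiplication by x+k and indefinite summation both preserve this
-- form (the latter just shifts the coefficients), so by induction on d every T_d is a
-- Newton series. Since C(k,j) is a polynomial in k, T_d is a polynomial P(x,k); it
-- vanishes at k = 0, so the part of P constant in k is zero and k divides P.

module Submission where

open import Defs
open import Data.Nat using (ℕ; zero; suc; _≤_)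
import Data.Nat.Properties as ℕ
open import Data.Nat.Coprimality using (1-coprimeTo) renaming (sym to coprime-sym)
open import Data.Integer using () renaming (+_ to +ℤ)
open import Data.List using (List; []; _∷_; map; _++_; upTo; _∷ʳ_)
open import Data.List.Properties using (map-++; upTo-∷ʳ)
open import Data.Product using (∃-syntax; _,_)
open import Data.Rational using (ℚ; 0ℚ; 1ℚ; _+_; _*_; _/_; mkℚ; -_; _-_; 1/_)
open import Data.Rational.Properties
  using (normalize-coprime; +-identityˡ; +-identityʳ; *-zeroʳ; *-zeroˡ; *-comm; *-inverseˡ; *-identityˡ)
open import Relation.Binary.PropositionalEquality
  using (_≡_; refl; sym; trans; cong; cong₂; module ≡-Reasoning)
open import Data.Rational.Solver using (module +-*-Solver)
open +-*-Solver

-- ℕ→ℚ n in normal form, on which 1/_ finds its NonZero instance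
ℕ→ℚ′ : ℕ → ℚ
ℕ→ℚ′ n = mkℚ (+ℤ n) 0 (coprime-sym (1-coprimeTo n))

ℕ→ℚ≡ℕ→ℚ′ : ∀ n → ℕ→ℚ n ≡ ℕ→ℚ′ n
ℕ→ℚ≡ℕ→ℚ′ n = normalize-coprime (coprime-sym (1-coprimeTo n))

ℕ→ℚ-suc : ∀ n → ℕ→ℚ (suc n) ≡ 1ℚ + ℕ→ℚ n
ℕ→ℚ-suc zero    = refl
ℕ→ℚ-suc (suc n) rewrite ℕ→ℚ≡ℕ→ℚ′ (suc n) =
  cong (λ m → +ℤ (suc (suc m)) / 1) (sym (ℕ.*-identityʳ n))

monomial : (ℕ → ℚ) → List ℕ → ℚ
monomial w γs = productℚ (map w γs)

esym : (ℕ → ℚ) → ℕ → List ℕ → ℚ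
esym w d L = sumℚ (map (monomial w) (combos d L))

sumℚ-++ : ∀ xs ys → sumℚ (xs ++ ys) ≡ sumℚ xs + sumℚ ys
sumℚ-++ []       ys = sym (+-identityˡ _)
sumℚ-++ (x ∷ xs) ys = trans (cong (x +_) (sumℚ-++ xs ys))
  (solve 3 (λ u v w → u :+ (v :+ w) := (u :+ v) :+ w) refl x (sumℚ xs) (sumℚ ys))

sumℚ-monomial-∷ : ∀ w a C →
  sumℚ (map (monomial w) (map (a ∷_) C)) ≡ w a * sumℚ (map (monomial w) C)
sumℚ-monomial-∷ w a []      = sym (*-zeroʳ (w a))
sumℚ-monomial-∷ w a (γ ∷ C) = trans (cong (w a * monomial w γ +_) (sumℚ-monomial-∷ w a C))
  (solve 3 (λ c p s → c :* p :+ c :* s := c :* (p :+ s)) refl (w a) (monomial w γ) _)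

esym-∷ : ∀ w d a L → esym w (suc d) (a ∷ L) ≡ w a * esym w d L + esym w (suc d) L
esym-∷ w d a L = begin
    sumℚ (map (monomial w) (map (a ∷_) (combos d L) ++ combos (suc d) L))
  ≡⟨ cong sumℚ (map-++ (monomial w) (map (a ∷_) (combos d L)) (combos (suc d) L)) ⟩
    sumℚ (map (monomial w) (map (a ∷_) (combos d L)) ++ map (monomial w) (combos (suc d) L))
  ≡⟨ sumℚ-++ (map (monomial w) (map (a ∷_) (combos d L))) _ ⟩
    sumℚ (map (monomial w) (map (a ∷_) (combos d L))) + esym w (suc d) L
  ≡⟨ cong (_+ esym w (suc d) L) (sumℚ-monomial-∷ w a (combos d L)) ⟩
    w a * esym w d L + esym w (suc d) L
  ∎ where open ≡-Reasoning

esym-∷ʳ : ∀ w d L a → esym w (suc d) (L ∷ʳ a) ≡ esym w (suc d) L + esym w d L * w a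
esym-∷ʳ w d       []      a = trans (esym-∷ w d a [])
  (solve 3 (λ A P Q → A :* P :+ Q := Q :+ P :* A) refl (w a) (esym w d []) (esym w (suc d) []))
esym-∷ʳ w zero    (b ∷ L) a = begin
    esym w 1 (b ∷ L ∷ʳ a)
  ≡⟨ esym-∷ w 0 b (L ∷ʳ a) ⟩
    w b * esym w 0 (L ∷ʳ a) + esym w 1 (L ∷ʳ a)
  ≡⟨ cong (w b * esym w 0 L +_) (esym-∷ʳ w 0 L a) ⟩
    w b * E₀ + (E₁ + E₀ * w a)
  ≡⟨ solve 4 (λ B P Q A → B :* P :+ (Q :+ P :* A) := (B :* P :+ Q) :+ P :* A)
       refl (w b) E₀ E₁ (w a) ⟩
    (w b * E₀ + E₁) + E₀ * w a
  ≡⟨ cong (_+ E₀ * w a) (sym (esym-∷ w 0 b L)) ⟩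
    esym w 1 (b ∷ L) + esym w 0 (b ∷ L) * w a
  ∎ where
    open ≡-Reasoning
    E₀ = esym w 0 L
    E₁ = esym w 1 L
esym-∷ʳ w (suc d) (b ∷ L) a = begin
    esym w (suc (suc d)) (b ∷ L ∷ʳ a)
  ≡⟨ esym-∷ w (suc d) b (L ∷ʳ a) ⟩
    w b * esym w (suc d) (L ∷ʳ a) + esym w (suc (suc d)) (L ∷ʳ a)
  ≡⟨ cong₂ (λ u v → w b * u + v) (esym-∷ʳ w d L a) (esym-∷ʳ w (suc d) L a) ⟩
    w b * (E₁ + E₀ * w a) + (E₂ + E₁ * w a)
  ≡⟨ solve 5 (λ B A E₀ E₁ E₂ → B :* (E₁ :+ E₀ :* A) :+ (E₂ :+ E₁ :* A)
                             := (B :* E₁ :+ E₂) :+ (B :* E₀ :+ E₁) :* A)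
       refl (w b) (w a) E₀ E₁ E₂ ⟩
    (w b * E₁ + E₂) + (w b * E₀ + E₁) * w a
  ≡⟨ cong₂ (λ u v → u + v * w a) (sym (esym-∷ w (suc d) b L)) (sym (esym-∷ w d b L)) ⟩
    esym w (suc (suc d)) (b ∷ L) + esym w (suc d) (b ∷ L) * w a
  ∎ where
    open ≡-Reasoning
    E₀ = esym w d L
    E₁ = esym w (suc d) L
    E₂ = esym w (suc (suc d)) L

addPoly : Poly → Poly → Poly
addPoly []       q        = q
addPoly (a ∷ p)  []       = a ∷ p
addPoly (a ∷ p)  (b ∷ q)  = (a + b) ∷ addPoly p q

evalPoly-addPoly : ∀ p q x → evalPoly (addPoly p q) x ≡ evalPoly p x + evalPoly q x
evalPoly-addPoly []      q       x = sym (+-identityˡ _)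
evalPoly-addPoly (a ∷ p) []      x = sym (+-identityʳ _)
evalPoly-addPoly (a ∷ p) (b ∷ q) x = trans (cong (λ z → (a + b) + x * z) (evalPoly-addPoly p q x))
  (solve 5 (λ a b x u v → (a :+ b) :+ x :* (u :+ v) := (a :+ x :* u) :+ (b :+ x :* v))
     refl a b x (evalPoly p x) (evalPoly q x))

scalePoly : ℚ → Poly → Poly
scalePoly c = map (c *_)

evalPoly-scalePoly : ∀ c p x → evalPoly (scalePoly c p) x ≡ c * evalPoly p x
evalPoly-scalePoly c []      x = sym (*-zeroʳ c)
evalPoly-scalePoly c (a ∷ p) x = trans (cong (λ z → c * a + x * z) (evalPoly-scalePoly c p x))
  (solve 4 (λ c a x u → c :* a :+ x :* (c :* u) := c :* (a :+ x :* u)) refl c a x (evalPoly p x))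

_⊗_ : Poly → Poly → Poly2
a ⊗ []       = []
a ⊗ (c ∷ cs) = scalePoly c a ∷ (a ⊗ cs)

eval2-⊗ : ∀ a b x k → eval2 (a ⊗ b) x k ≡ evalPoly a x * evalPoly b k
eval2-⊗ a []       x k = sym (*-zeroʳ (evalPoly a x))
eval2-⊗ a (c ∷ cs) x k =
  trans (cong₂ (λ u v → u + k * v) (evalPoly-scalePoly c a x) (eval2-⊗ a cs x k))
  (solve 4 (λ c A k E → c :* A :+ k :* (A :* E) := A :* (c :+ k :* E))
     refl c (evalPoly a x) k (evalPoly cs k))

addPoly2 : Poly2 → Poly2 → Poly2
addPoly2 []      q       = q
addPoly2 (a ∷ p) []      = a ∷ p
addPoly2 (a ∷ p) (b ∷ q) = addPoly a b ∷ addPoly2 p q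

eval2-addPoly2 : ∀ p q x k → eval2 (addPoly2 p q) x k ≡ eval2 p x k + eval2 q x k
eval2-addPoly2 []      q       x k = sym (+-identityˡ _)
eval2-addPoly2 (a ∷ p) []      x k = sym (+-identityʳ _)
eval2-addPoly2 (a ∷ p) (b ∷ q) x k =
  trans (cong₂ (λ u v → u + k * v) (evalPoly-addPoly a b x) (eval2-addPoly2 p q x k))
  (solve 5 (λ a b k u v → (a :+ b) :+ k :* (u :+ v) := (a :+ k :* u) :+ (b :+ k :* v))
     refl (evalPoly a x) (evalPoly b x) k (eval2 p x k) (eval2 q x k))

eval2-divisible : ∀ P → (∀ x → eval2 P x 0ℚ ≡ 0ℚ) →
  ∃[ Q ] (∀ x k → eval2 P x k ≡ k * eval2 Q x k)
eval2-divisible []       _     = [] , λ x k → sym (*-zeroʳ k)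
eval2-divisible (p ∷ ps) P[0]≡0 = ps , λ x k →
  trans (cong (_+ k * eval2 ps x k) (p≡0 x)) (+-identityˡ _)
  where
  p≡0 : ∀ x → evalPoly p x ≡ 0ℚ
  p≡0 x = begin
      evalPoly p x                      ≡⟨ sym (+-identityʳ _) ⟩
      evalPoly p x + 0ℚ                 ≡⟨ cong (evalPoly p x +_) (sym (*-zeroˡ (eval2 ps x 0ℚ))) ⟩
      evalPoly p x + 0ℚ * eval2 ps x 0ℚ ≡⟨ P[0]≡0 x ⟩
      0ℚ                                ∎
    where open ≡-Reasoning

binomial : ℕ → ℕ → ℚ
binomial k       zero    = 1ℚ
binomial zero    (suc j) = 0ℚ
binomial (suc k) (suc j) = binomial k j + binomial k (suc j)

ℕ→ℚ-2+ : ∀ n → ℕ→ℚ (suc (suc n)) ≡ 1ℚ + (1ℚ + ℕ→ℚ n)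
ℕ→ℚ-2+ n = trans (ℕ→ℚ-suc (suc n)) (cong (1ℚ +_) (ℕ→ℚ-suc n))

binomial-suc : ∀ k j → ℕ→ℚ (suc j) * binomial k (suc j) ≡ (ℕ→ℚ k - ℕ→ℚ j) * binomial k j
binomial-suc zero    zero    = refl
binomial-suc zero    (suc j) = trans (*-zeroʳ (ℕ→ℚ (suc (suc j)))) (sym (*-zeroʳ (0ℚ - ℕ→ℚ (suc j))))
binomial-suc (suc k) zero    = begin
    1ℚ * (1ℚ + binomial k 1)
  ≡⟨ solve 1 (λ c → con 1ℚ :* (con 1ℚ :+ c) := con 1ℚ :+ con 1ℚ :* c) refl (binomial k 1) ⟩
    1ℚ + 1ℚ * binomial k 1
  ≡⟨ cong (1ℚ +_) (binomial-suc k zero) ⟩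
    1ℚ + (ℕ→ℚ k - 0ℚ) * 1ℚ
  ≡⟨ solve 1 (λ K → con 1ℚ :+ (K :- con 0ℚ) :* con 1ℚ := ((con 1ℚ :+ K) :- con 0ℚ) :* con 1ℚ)
       refl (ℕ→ℚ k) ⟩
    ((1ℚ + ℕ→ℚ k) - 0ℚ) * 1ℚ
  ≡⟨ cong (λ z → (z - 0ℚ) * 1ℚ) (sym (ℕ→ℚ-suc k)) ⟩
    (ℕ→ℚ (suc k) - 0ℚ) * 1ℚ
  ∎ where open ≡-Reasoning
binomial-suc (suc k) (suc j) = begin
    ℕ→ℚ (suc (suc j)) * (C₁ + C₂)
  ≡⟨ solve 3 (λ N A B → N :* (A :+ B) := N :* A :+ N :* B) refl (ℕ→ℚ (suc (suc j))) C₁ C₂ ⟩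
    ℕ→ℚ (suc (suc j)) * C₁ + ℕ→ℚ (suc (suc j)) * C₂
  ≡⟨ cong (ℕ→ℚ (suc (suc j)) * C₁ +_) (binomial-suc k (suc j)) ⟩
    ℕ→ℚ (suc (suc j)) * C₁ + (K - ℕ→ℚ (suc j)) * C₁
  ≡⟨ cong₂ (λ u v → u * C₁ + (K - v) * C₁) (ℕ→ℚ-2+ j) (ℕ→ℚ-suc j) ⟩
    (1ℚ + (1ℚ + J)) * C₁ + (K - (1ℚ + J)) * C₁
  ≡⟨ solve 3 (λ K J C → (con 1ℚ :+ (con 1ℚ :+ J)) :* C :+ (K :- (con 1ℚ :+ J)) :* C
                      := (K :- J) :* C :+ (con 1ℚ :+ J) :* C) refl K J C₁ ⟩
    (K - J) * C₁ + (1ℚ + J) * C₁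
  ≡⟨ cong (λ u → (K - J) * C₁ + u * C₁) (sym (ℕ→ℚ-suc j)) ⟩
    (K - J) * C₁ + ℕ→ℚ (suc j) * C₁
  ≡⟨ cong ((K - J) * C₁ +_) (binomial-suc k j) ⟩
    (K - J) * C₁ + (K - J) * C₀
  ≡⟨ solve 5 (λ K J A C₀ C₁ → (K :- J) :* C₁ :+ (K :- J) :* C₀
                            := ((A :+ K) :- (A :+ J)) :* (C₀ :+ C₁)) refl K J 1ℚ C₀ C₁ ⟩
    ((1ℚ + K) - (1ℚ + J)) * (C₀ + C₁)
  ≡⟨ cong₂ (λ u v → (u - v) * (C₀ + C₁)) (sym (ℕ→ℚ-suc k)) (sym (ℕ→ℚ-suc j)) ⟩
    (ℕ→ℚ (suc k) - ℕ→ℚ (suc j)) * (C₀ + C₁)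
  ∎ where
    open ≡-Reasoning
    K = ℕ→ℚ k
    J = ℕ→ℚ j
    C₀ = binomial k j
    C₁ = binomial k (suc j)
    C₂ = binomial k (suc (suc j))

binomialPoly : ℕ → Poly
binomialPoly zero    = 1ℚ ∷ []
binomialPoly (suc j) =
  scalePoly (1/ ℕ→ℚ′ (suc j)) (addPoly (0ℚ ∷ binomialPoly j) (scalePoly (- ℕ→ℚ j) (binomialPoly j)))

evalPoly-binomialPoly : ∀ j k → evalPoly (binomialPoly j) (ℕ→ℚ k) ≡ binomial k j
evalPoly-binomialPoly zero    k = trans (cong (1ℚ +_) (*-zeroʳ (ℕ→ℚ k))) (+-identityʳ 1ℚ)
evalPoly-binomialPoly (suc j) k = begin
    evalPoly (binomialPoly (suc j)) K
  ≡⟨ evalPoly-scalePoly i (addPoly (0ℚ ∷ binomialPoly j) (scalePoly (- J) (binomialPoly j))) K ⟩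
    i * evalPoly (addPoly (0ℚ ∷ binomialPoly j) (scalePoly (- J) (binomialPoly j))) K
  ≡⟨ cong (i *_) (evalPoly-addPoly (0ℚ ∷ binomialPoly j) (scalePoly (- J) (binomialPoly j)) K) ⟩
    i * ((0ℚ + K * evalPoly (binomialPoly j) K) + evalPoly (scalePoly (- J) (binomialPoly j)) K)
  ≡⟨ cong (λ v → i * ((0ℚ + K * evalPoly (binomialPoly j) K) + v))
       (evalPoly-scalePoly (- J) (binomialPoly j) K) ⟩
    i * ((0ℚ + K * evalPoly (binomialPoly j) K) + (- J) * evalPoly (binomialPoly j) K)
  ≡⟨ cong (λ u → i * ((0ℚ + K * u) + (- J) * u)) (evalPoly-binomialPoly j k) ⟩
    i * ((0ℚ + K * binomial k j) + (- J) * binomial k j)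
  ≡⟨ solve 4 (λ i K J C → i :* ((con 0ℚ :+ K :* C) :+ (:- J) :* C) := i :* ((K :- J) :* C))
       refl i K J (binomial k j) ⟩
    i * ((K - J) * binomial k j)
  ≡⟨ cong (i *_) (sym (binomial-suc k j)) ⟩
    i * (ℕ→ℚ (suc j) * binomial k (suc j))
  ≡⟨ cong (λ z → i * (z * binomial k (suc j))) (ℕ→ℚ≡ℕ→ℚ′ (suc j)) ⟩
    i * (ℕ→ℚ′ (suc j) * binomial k (suc j))
  ≡⟨ solve 3 (λ i n c → i :* (n :* c) := (i :* n) :* c) refl i (ℕ→ℚ′ (suc j)) (binomial k (suc j)) ⟩
    (i * ℕ→ℚ′ (suc j)) * binomial k (suc j)
  ≡⟨ cong (_* binomial k (suc j)) (*-inverseˡ (ℕ→ℚ′ (suc j))) ⟩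
    1ℚ * binomial k (suc j)
  ≡⟨ *-identityˡ _ ⟩
    binomial k (suc j)
  ∎ where
    open ≡-Reasoning
    K = ℕ→ℚ k
    J = ℕ→ℚ j
    i = 1/ ℕ→ℚ′ (suc j)

-- (a₀, a₁, …) stands for Σ_j a_j(x) C(k,j): a₀ is the value at k = 0 and the tail is
-- the forward difference in k.
Newton : Set
Newton = List Poly

newton : Newton → ℚ → ℕ → ℚ
newton []       x k       = 0ℚ
newton (a ∷ as) x zero    = evalPoly a x
newton (a ∷ as) x (suc k) = newton (a ∷ as) x k + newton as x k

addNewton : Newton → Newton → Newton
addNewton []      q       = q
addNewton (a ∷ p) []      = a ∷ p
addNewton (a ∷ p) (b ∷ q) = addPoly a b ∷ addNewton p q

newton-addNewton : ∀ p q x k → newton (addNewton p q) x k ≡ newton p x k + newton q x k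
newton-addNewton []      q       x k       = sym (+-identityˡ _)
newton-addNewton (a ∷ p) []      x k       = sym (+-identityʳ _)
newton-addNewton (a ∷ p) (b ∷ q) x zero    = evalPoly-addPoly a b x
newton-addNewton (a ∷ p) (b ∷ q) x (suc k) =
  trans (cong₂ _+_ (newton-addNewton (a ∷ p) (b ∷ q) x k) (newton-addNewton p q x k))
  (solve 4 (λ u v w z → (u :+ w) :+ (v :+ z) := (u :+ v) :+ (w :+ z)) refl
     (newton (a ∷ p) x k) (newton p x k) (newton (b ∷ q) x k) (newton q x k))

-- Δ((x+k) f) = (x+k) Δf + (Δf + f)
mulX+k : Newton → Newton
mulX+k []       = []
mulX+k (a ∷ as) = (0ℚ ∷ a) ∷ addNewton (mulX+k as) (addNewton as (a ∷ as))

newton-mulX+k : ∀ as x k → newton (mulX+k as) x k ≡ (x + ℕ→ℚ k) * newton as x k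
newton-mulX+k []       x k       = sym (*-zeroʳ (x + ℕ→ℚ k))
newton-mulX+k (a ∷ as) x zero    =
  solve 2 (λ x e → con 0ℚ :+ x :* e := (x :+ con 0ℚ) :* e) refl x (evalPoly a x)
newton-mulX+k (a ∷ as) x (suc k) = begin
    newton (mulX+k (a ∷ as)) x k + newton (addNewton (mulX+k as) (addNewton as (a ∷ as))) x k
  ≡⟨ cong₂ _+_ (newton-mulX+k (a ∷ as) x k)
       (trans (newton-addNewton (mulX+k as) (addNewton as (a ∷ as)) x k)
              (cong₂ _+_ (newton-mulX+k as x k) (newton-addNewton as (a ∷ as) x k))) ⟩
    (x + K) * f + ((x + K) * Δf + (Δf + f))
  ≡⟨ solve 4 (λ x K f Δf → (x :+ K) :* f :+ ((x :+ K) :* Δf :+ (Δf :+ f))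
                         := (x :+ (con 1ℚ :+ K)) :* (f :+ Δf)) refl x K f Δf ⟩
    (x + (1ℚ + K)) * (f + Δf)
  ≡⟨ cong (λ z → (x + z) * (f + Δf)) (sym (ℕ→ℚ-suc k)) ⟩
    (x + ℕ→ℚ (suc k)) * (f + Δf)
  ∎ where
    open ≡-Reasoning
    K  = ℕ→ℚ k
    f  = newton (a ∷ as) x k
    Δf = newton as x k

binomialSum : ℕ → Newton → ℚ → ℕ → ℚ
binomialSum j []       x k = 0ℚ
binomialSum j (a ∷ as) x k = evalPoly a x * binomial k j + binomialSum (suc j) as x k

binomialSum-zero : ∀ j as x → binomialSum (suc j) as x 0 ≡ 0ℚ
binomialSum-zero j []       x = refl
binomialSum-zero j (a ∷ as) x =
  trans (cong₂ _+_ (*-zeroʳ (evalPoly a x)) (binomialSum-zero (suc j) as x)) (+-identityʳ 0ℚ)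

binomialSum-suc : ∀ j as x k →
  binomialSum (suc j) as x (suc k) ≡ binomialSum j as x k + binomialSum (suc j) as x k
binomialSum-suc j []       x k = sym (+-identityʳ 0ℚ)
binomialSum-suc j (a ∷ as) x k =
  trans (cong (λ z → evalPoly a x * (binomial k j + binomial k (suc j)) + z) (binomialSum-suc (suc j) as x k))
  (solve 5 (λ a c d u v → a :* (c :+ d) :+ (u :+ v) := (a :* c :+ u) :+ (a :* d :+ v)) refl
    (evalPoly a x) (binomial k j) (binomial k (suc j))
    (binomialSum (suc j) as x k) (binomialSum (suc (suc j)) as x k))

newton≡binomialSum : ∀ as x k → newton as x k ≡ binomialSum 0 as x k
newton≡binomialSum []       x k       = refl
newton≡binomialSum (a ∷ as) x zero    =
  trans (solve 1 (λ e → e := e :* con 1ℚ :+ con 0ℚ) refl (evalPoly a x))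
        (cong (evalPoly a x * 1ℚ +_) (sym (binomialSum-zero 0 as x)))
newton≡binomialSum (a ∷ as) x (suc k) =
  trans (cong₂ _+_ (newton≡binomialSum (a ∷ as) x k) (newton≡binomialSum as x k))
  (trans (solve 3 (λ e u v → (e :* con 1ℚ :+ u) :+ v := e :* con 1ℚ :+ (v :+ u)) refl
            (evalPoly a x) (binomialSum 1 as x k) (binomialSum 0 as x k))
         (cong (evalPoly a x * 1ℚ +_) (sym (binomialSum-suc 0 as x k))))

binomialSumPoly : ℕ → Newton → Poly2
binomialSumPoly j []       = []
binomialSumPoly j (a ∷ as) = addPoly2 (a ⊗ binomialPoly j) (binomialSumPoly (suc j) as)

eval2-binomialSumPoly : ∀ j as x k → eval2 (binomialSumPoly j as) x (ℕ→ℚ k) ≡ binomialSum j as x k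
eval2-binomialSumPoly j []       x k = refl
eval2-binomialSumPoly j (a ∷ as) x k =
  trans (eval2-addPoly2 (a ⊗ binomialPoly j) (binomialSumPoly (suc j) as) x (ℕ→ℚ k))
  (cong₂ _+_ (trans (eval2-⊗ a (binomialPoly j) x (ℕ→ℚ k))
                    (cong (evalPoly a x *_) (evalPoly-binomialPoly j k)))
             (eval2-binomialSumPoly (suc j) as x k))

newton-polynomial : ∀ as → ∃[ P ] (∀ k x → newton as x k ≡ eval2 P x (ℕ→ℚ k))
newton-polynomial as = binomialSumPoly 0 as , λ k x →
  trans (newton≡binomialSum as x k) (sym (eval2-binomialSumPoly 0 as x k))

T-suc : ∀ d k x → T (suc d) (suc k) x ≡ T (suc d) k x + T d k x * (x + ℕ→ℚ k)
T-suc d k x = trans (cong (esym (λ g → x + ℕ→ℚ g) (suc d)) (sym (upTo-∷ʳ k)))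
  (esym-∷ʳ (λ g → x + ℕ→ℚ g) d (upTo k) k)

T-newtonSeries : ℕ → Newton
T-newtonSeries zero    = (1ℚ ∷ []) ∷ []
T-newtonSeries (suc d) = [] ∷ mulX+k (T-newtonSeries d)

T≡newton : ∀ d k x → T d k x ≡ newton (T-newtonSeries d) x k
T≡newton zero    zero    x = cong (1ℚ +_) (sym (*-zeroʳ x))
T≡newton zero    (suc k) x = trans (T≡newton zero k x) (sym (+-identityʳ _))
T≡newton (suc d) zero    x = refl
T≡newton (suc d) (suc k) x = trans (T-suc d k x)
  (cong₂ _+_ (T≡newton (suc d) k x)
     (trans (cong (_* (x + ℕ→ℚ k)) (T≡newton d k x))
       (trans (*-comm _ (x + ℕ→ℚ k)) (sym (newton-mulX+k (T-newtonSeries d) x k)))))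

T-polynomial : ∀ d → ∃[ P ] (∀ k x → T d k x ≡ eval2 P x (ℕ→ℚ k))
T-polynomial d =
  let P , newton≡P = newton-polynomial (T-newtonSeries d)
  in P , λ k x → trans (T≡newton d k x) (newton≡P k x)

propositionA3 : (d : ℕ) → 1 ≤ d →
    ∃[ Q ] ((k : ℕ) (x : ℚ) → T d k x ≡ ℕ→ℚ k * eval2 Q x (ℕ→ℚ k))
propositionA3 (suc d) _ =
  let P , T≡P  = T-polynomial (suc d)
      Q , P≡kQ = eval2-divisible P (λ x → sym (T≡P 0 x))
  in Q , λ k x → trans (T≡P k x) (P≡kQ x (ℕ→ℚ k))
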